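{- Let $L\in\mathrm{Mat}_N(\mathbb{Z})$ be the Gram matrix of an even positive definite lattice and let $\mathcal{R}\subset\mathbb{Z}^N$ be a finite set. Then there is a complete set of restriction vectors for $\mathcal{R}$, i.e. a finite set $\mathcal{S}\subset\mathbb{Z}\times L\mathbb{Z}^N$ such that the matrix $F(\mathcal{R},\mathcal{S})=\big(\mathrm{mult}(r)\,\delta_{s^{\mathrm{tr}}r=\tilde r}\big)_{r\in\mathcal{R},\,(\tilde r,s)\in\mathcal{S}}$ has rank $\#\mathcal{R}$.
   Context: $L[x]=x^{\mathrm{tr}}Lx$. For $r\in\mathbb{Z}^N$, $\mathrm{neigh}(r)=\{r'\in r+L\mathbb{Z}^N: L[r']=L[r]\}$ and $\mathrm{mult}(r)=\#\mathrm{neigh}(r)$. $\delta_{s^{\mathrm{tr}}r=\tilde r}$ is $1$ if $s^{\mathrm{tr}}r=\tilde r$ and $0$ otherwise. -}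

module Defs where

open import Data.Nat as ℕ using (ℕ; zero; suc)
open import Data.Integer as ℤ using (ℤ; +_)
open import Data.Integer.Divisibility using () renaming (_∣_ to _∣ℤ_)
open import Data.Rational as ℚ using (ℚ; 0ℚ)
open import Data.Fin using (Fin; zero; suc)
open import Data.Vec using (Vec; zipWith; map; lookup; replicate)
import Data.Vec as V
open import Data.List using (List; length)
open import Data.List.Membership.Propositional using (_∈_)
open import Data.List.Relation.Unary.Unique.Propositional using (Unique)
open import Data.Product using (Σ; ∃; _×_; proj₁; proj₂)
open import Data.Bool using (if_then_else_)
open import Relation.Nullary using (¬_)
open import Relation.Nullary.Decidable using (⌊_⌋)
open import Relation.Binary.PropositionalEquality using (_≡_)
open import Function.Bundles using (_⇔_)

Vecℤ : ℕ → Set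
Vecℤ N = Vec ℤ N

Mat : ℕ → Set
Mat N = Vec (Vec ℤ N) N

entry : ∀ {N} → Mat N → Fin N → Fin N → ℤ
entry L i j = lookup (lookup L i) j

dot : ∀ {N} → Vecℤ N → Vecℤ N → ℤ
dot x y = V.foldr _ ℤ._+_ (+ 0) (zipWith ℤ._*_ x y)

_·_ : ∀ {N} → Mat N → Vecℤ N → Vecℤ N
L · y = map (λ row → dot row y) L

_+ᵥ_ : ∀ {N} → Vecℤ N → Vecℤ N → Vecℤ N
x +ᵥ y = zipWith ℤ._+_ x y

Q : ∀ {N} → Mat N → Vecℤ N → ℤ
Q L x = dot x (L · x)

record IsEvenPosDefGram {N : ℕ} (L : Mat N) : Set where
  field
    symmetric : ∀ i j → entry L i j ≡ entry L j i
    even      : ∀ x → (+ 2) ∣ℤ Q L x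
    posdef    : ∀ x → ¬ (x ≡ replicate N (+ 0)) → (+ 0) ℤ.< Q L x

InLZ : ∀ {N} → Mat N → Vecℤ N → Set
InLZ L s = ∃ λ y → s ≡ L · y

IsNeigh : ∀ {N} → Mat N → Vecℤ N → Vecℤ N → Set
IsNeigh L r r' = (∃ λ y → r' ≡ r +ᵥ (L · y)) × (Q L r' ≡ Q L r)

-- "mult(r) = k": neigh(r) has exactly k elements
-- (it is enumerated by a duplicate-free list of length k)
IsMult : ∀ {N} → Mat N → Vecℤ N → ℕ → Set
IsMult {N} L r k =
  ∃ λ (xs : List (Vecℤ N)) →
    Unique xs × length xs ≡ k × (∀ r' → (r' ∈ xs) ⇔ IsNeigh L r r')

Fmat : ∀ {N n m} → (Vecℤ N → ℕ) → (Fin n → Vecℤ N) → (Fin m → ℤ × Vecℤ N)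
       → Fin n → Fin m → ℤ
Fmat mult R S i j =
  if ⌊ dot (proj₂ (S j)) (R i) ℤ.≟ proj₁ (S j) ⌋ then + mult (R i) else + 0

sumℚ : ∀ {n} → (Fin n → ℚ) → ℚ
sumℚ {zero}  f = 0ℚ
sumℚ {suc n} f = f zero ℚ.+ sumℚ (λ i → f (suc i))

HasRankRows : ∀ {n m} → (Fin n → Fin m → ℤ) → Set
HasRankRows {n} {m} F =
  ∀ (c : Fin n → ℚ) →
    (∀ j → sumℚ (λ i → c i ℚ.* (F i j ℚ./ 1)) ≡ 0ℚ) →
    ∀ i → c i ≡ 0ℚ

-- Take S = {(L[r], L r) : r ∈ R}. The entry of F at (r, (L[r'], L r')) is nonzero
-- only if (L r')ᵀ r = L[r'], and then, for r ≠ r', positive definiteness gives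
-- 0 < L[r − r'] = L[r] − L[r']. So F is triangular once R is ordered by L[r], and
-- its diagonal entries mult(r) are positive because r ∈ neigh(r); hence F has full
-- row rank.

{-# OPTIONS --safe #-}
module Submission where

open import Defs
open import Data.Nat using (ℕ)
open import Data.Integer using (ℤ)
open import Data.Fin using (Fin)
open import Data.Product using (∃; _×_; proj₂)
open import Function.Definitions using (Injective)
open import Relation.Binary.PropositionalEquality using (_≡_)

open import Data.Nat as ℕ using (zero; suc)
open import Data.Integer as ℤ using (+_; 0ℤ; _+_; _-_; _*_; _<_; _≤_; _⊔_; ∣_∣)
import Data.Integer.Properties as ℤP
open import Data.Integer.GCD using (gcd)
open import Data.Integer.Tactic.RingSolver using (solve-∀)
open import Data.Rational as ℚ using (ℚ; 0ℚ; ↥_)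
import Data.Rational.Properties as ℚP
open import Data.Fin using (zero; suc)
import Data.Fin.Properties as FinP
open import Data.Vec using ([]; _∷_; lookup; replicate; zipWith)
import Data.Vec.Properties as VecP
open import Data.List.Membership.Propositional.Properties using (∈-length)
open import Data.Product using (_,_; proj₁; ∃-syntax)
open import Data.Empty using (⊥-elim)
open import Function.Base using (_∘_)
open import Function.Bundles using (Equivalence)
open import Relation.Nullary using (yes; no; contradiction)
open import Relation.Binary.PropositionalEquality
  using (_≢_; refl; sym; trans; cong; cong₂; subst; subst₂; module ≡-Reasoning)
open import Algebra.Properties.Semiring.Sum ℤP.+-*-semiring
  using (sum-syntax; ∑-comm; *-distribˡ-sum; sum-cong-≗)

open ≡-Reasoning

i/1≢0 : ∀ {i} → i ≢ 0ℤ → i ℚ./ 1 ≢ 0ℚ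
i/1≢0 {i} i≢0 i/1≡0 = i≢0 (begin
  i                         ≡⟨ ℚP.↥-/ i 1 ⟨
  ↥ (i ℚ./ 1) * gcd i (+ 1) ≡⟨ cong (λ p → ↥ p * gcd i (+ 1)) i/1≡0 ⟩
  0ℤ * gcd i (+ 1)          ≡⟨ ℤP.*-zeroˡ (gcd i (+ 1)) ⟩
  0ℤ                        ∎)

p*q≡0⇒p≡0 : ∀ p {q} → q ≢ 0ℚ → p ℚ.* q ≡ 0ℚ → p ≡ 0ℚ
p*q≡0⇒p≡0 p {q} q≢0 pq≡0 = begin
  p                    ≡⟨ ℚP.*-identityʳ p ⟨
  p ℚ.* ℚ.1ℚ           ≡⟨ cong (p ℚ.*_) (ℚP.*-inverseʳ q) ⟨
  p ℚ.* (q ℚ.* ℚ.1/ q) ≡⟨ ℚP.*-assoc p q (ℚ.1/ q) ⟨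
  (p ℚ.* q) ℚ.* ℚ.1/ q ≡⟨ cong (ℚ._* ℚ.1/ q) pq≡0 ⟩
  0ℚ ℚ.* ℚ.1/ q        ≡⟨ ℚP.*-zeroˡ (ℚ.1/ q) ⟩
  0ℚ                   ∎
  where instance _ = ℚ.≢-nonZero q≢0

sumℚ-zero : ∀ {n} (f : Fin n → ℚ) → (∀ i → f i ≡ 0ℚ) → sumℚ f ≡ 0ℚ
sumℚ-zero {zero}  f f≡0 = refl
sumℚ-zero {suc n} f f≡0 =
  cong₂ ℚ._+_ (f≡0 zero) (sumℚ-zero (λ i → f (suc i)) (λ i → f≡0 (suc i)))

sumℚ-single : ∀ {n} (f : Fin n → ℚ) j → (∀ i → i ≢ j → f i ≡ 0ℚ) → sumℚ f ≡ f j
sumℚ-single {suc n} f zero f≡0 = begin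
  f zero ℚ.+ sumℚ (λ i → f (suc i)) ≡⟨ cong (f zero ℚ.+_) (sumℚ-zero _ (λ i → f≡0 (suc i) λ ())) ⟩
  f zero ℚ.+ 0ℚ                     ≡⟨ ℚP.+-identityʳ (f zero) ⟩
  f zero                            ∎
sumℚ-single {suc n} f (suc j) f≡0 = begin
  f zero ℚ.+ sumℚ (λ i → f (suc i)) ≡⟨ cong₂ ℚ._+_ (f≡0 zero λ ()) (sumℚ-single _ j f'≡0) ⟩
  0ℚ ℚ.+ f (suc j)                  ≡⟨ ℚP.+-identityˡ (f (suc j)) ⟩
  f (suc j)                         ∎
  where
  f'≡0 : ∀ i → i ≢ j → f (suc i) ≡ 0ℚ
  f'≡0 i i≢j = f≡0 (suc i) (i≢j ∘ FinP.suc-injective)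

bounded-above : ∀ {n} (q : Fin n → ℤ) → ∃[ B ] (∀ i → q i ≤ B)
bounded-above {zero}  q = 0ℤ , λ ()
bounded-above {suc n} q with bounded-above (λ i → q (suc i))
... | B , q∘suc≤B = q zero ⊔ B , λ where
  zero    → ℤP.i≤i⊔j (q zero) B
  (suc i) → ℤP.i≤j⇒i≤k⊔j (q zero) (q∘suc≤B i)

descending-induction : ∀ {a p} {A : Set a} (q : A → ℤ) {B : ℤ} → (∀ x → q x ≤ B) →
  (P : A → Set p) → (∀ x → (∀ y → q x < q y → P y) → P x) → ∀ x → P x
descending-induction q {B} q≤B P step x = go ∣ B - q x ∣ x B≤q+gap
  where
  go : ∀ t x → B ≤ q x + + t → P x
  go zero x B≤qx+0 = step x λ y qx<qy →
    contradiction (q≤B y) (ℤP.<⇒≱ (ℤP.≤-<-trans (subst (B ≤_) (ℤP.+-identityʳ (q x)) B≤qx+0) qx<qy))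
  go (suc t) x B≤qx+1+t = step x λ y qx<qy →
    go t y (ℤP.≤-trans B≤qx+1+t
      (subst (_≤ q y + + t) (shift (q x) (+ t)) (ℤP.+-monoˡ-≤ (+ t) (ℤP.i<j⇒suc[i]≤j qx<qy))))
    where
    shift : ∀ i j → (+ 1 + i) + j ≡ i + (+ 1 + j)
    shift = solve-∀
  B≤q+gap : B ≤ q x + + ∣ B - q x ∣
  B≤q+gap = ℤP.≤-reflexive (begin
    B                   ≡⟨ cancel (q x) B ⟩
    q x + (B - q x)     ≡⟨ cong (λ k → q x + k) (ℤP.0≤i⇒+∣i∣≡i (ℤP.i≤j⇒0≤j-i (q≤B x))) ⟨
    q x + + ∣ B - q x ∣ ∎)
    where
    cancel : ∀ i j → j ≡ i + (j - i)
    cancel = solve-∀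

triangular⇒HasRankRows : ∀ {n} (F : Fin n → Fin n → ℤ) (q : Fin n → ℤ) →
  (∀ j → F j j ≢ 0ℤ) → (∀ i j → i ≢ j → F i j ≢ 0ℤ → q j < q i) → HasRankRows F
triangular⇒HasRankRows F q Fjj≢0 triangular c ∑cF≡0 =
  descending-induction q (proj₂ (bounded-above q)) (λ j → c j ≡ 0ℚ) step
  where
  step : ∀ j → (∀ i → q j < q i → c i ≡ 0ℚ) → c j ≡ 0ℚ
  step j c≡0-above = p*q≡0⇒p≡0 (c j) (i/1≢0 (Fjj≢0 j))
    (trans (sym (sumℚ-single _ j off-diagonal)) (∑cF≡0 j))
    where
    off-diagonal : ∀ i → i ≢ j → c i ℚ.* (F i j ℚ./ 1) ≡ 0ℚ
    off-diagonal i i≢j with F i j ℤ.≟ 0ℤ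
    ... | yes Fij≡0 = trans (cong (λ z → c i ℚ.* (z ℚ./ 1)) Fij≡0) (ℚP.*-zeroʳ (c i))
    ... | no Fij≢0  = trans (cong (ℚ._* (F i j ℚ./ 1)) (c≡0-above i (triangular i j i≢j Fij≢0)))
                            (ℚP.*-zeroˡ (F i j ℚ./ 1))

_-ᵥ_ : ∀ {N} → Vecℤ N → Vecℤ N → Vecℤ N
x -ᵥ y = zipWith _-_ x y

-ᵥ≡0⇒≡ : ∀ {N} (x y : Vecℤ N) → x -ᵥ y ≡ replicate N 0ℤ → x ≡ y
-ᵥ≡0⇒≡ []      []      _     = refl
-ᵥ≡0⇒≡ (a ∷ x) (b ∷ y) x-y≡0 =
  cong₂ _∷_ (ℤP.i-j≡0⇒i≡j a b (VecP.∷-injectiveˡ x-y≡0)) (-ᵥ≡0⇒≡ x y (VecP.∷-injectiveʳ x-y≡0))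

dot-comm : ∀ {N} (x y : Vecℤ N) → dot x y ≡ dot y x
dot-comm []      []      = refl
dot-comm (a ∷ x) (b ∷ y) = cong₂ _+_ (ℤP.*-comm a b) (dot-comm x y)

dot-zeroʳ : ∀ {N} (x : Vecℤ N) → dot x (replicate N 0ℤ) ≡ 0ℤ
dot-zeroʳ []      = refl
dot-zeroʳ (a ∷ x) = cong₂ _+_ (ℤP.*-zeroʳ a) (dot-zeroʳ x)

dot-subˡ : ∀ {N} (x y z : Vecℤ N) → dot (x -ᵥ y) z ≡ dot x z - dot y z
dot-subˡ []      []      []      = refl
dot-subˡ (a ∷ x) (b ∷ y) (c ∷ z) =
  trans (cong (_+_ ((a - b) * c)) (dot-subˡ x y z)) (interchange a b c (dot x z) (dot y z))
  where
  interchange : ∀ a b c u v → (a - b) * c + (u - v) ≡ (a * c + u) - (b * c + v)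
  interchange = solve-∀

dot≡∑ : ∀ {N} (x y : Vecℤ N) → dot x y ≡ ∑[ k < N ] (lookup x k * lookup y k)
dot≡∑ []      []      = refl
dot≡∑ (a ∷ x) (b ∷ y) = cong (_+_ (a * b)) (dot≡∑ x y)

dot-·≡∑∑ : ∀ {N} (L : Mat N) (x y : Vecℤ N) →
  dot x (L · y) ≡ ∑[ k < N ] ∑[ l < N ] (lookup x k * (entry L k l * lookup y l))
dot-·≡∑∑ {N} L x y = begin
  dot x (L · y)
    ≡⟨ dot≡∑ x (L · y) ⟩
  ∑[ k < N ] (lookup x k * lookup (L · y) k)
    ≡⟨ sum-cong-≗ (λ k → cong (lookup x k *_) (row-k k)) ⟩
  ∑[ k < N ] (lookup x k * ∑[ l < N ] (entry L k l * lookup y l))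
    ≡⟨ sum-cong-≗ (λ k → *-distribˡ-sum (lookup x k) (λ l → entry L k l * lookup y l)) ⟩
  ∑[ k < N ] ∑[ l < N ] (lookup x k * (entry L k l * lookup y l)) ∎
  where
  row-k : ∀ k → lookup (L · y) k ≡ ∑[ l < N ] (entry L k l * lookup y l)
  row-k k = trans (VecP.lookup-map k (λ row → dot row y) L) (dot≡∑ (lookup L k) y)

dot-·-comm : ∀ {N} (L : Mat N) → (∀ i j → entry L i j ≡ entry L j i) →
  ∀ x y → dot x (L · y) ≡ dot y (L · x)
dot-·-comm {N} L L-sym x y = begin
  dot x (L · y)
    ≡⟨ dot-·≡∑∑ L x y ⟩
  ∑[ k < N ] ∑[ l < N ] (lookup x k * (entry L k l * lookup y l))
    ≡⟨ ∑-comm (λ k l → lookup x k * (entry L k l * lookup y l)) ⟩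
  ∑[ l < N ] ∑[ k < N ] (lookup x k * (entry L k l * lookup y l))
    ≡⟨ sum-cong-≗ (λ l → sum-cong-≗ (λ k → transposed k l)) ⟩
  ∑[ l < N ] ∑[ k < N ] (lookup y l * (entry L l k * lookup x k))
    ≡⟨ dot-·≡∑∑ L y x ⟨
  dot y (L · x) ∎
  where
  swap : ∀ a m b → a * (m * b) ≡ b * (m * a)
  swap = solve-∀
  transposed : ∀ k l → lookup x k * (entry L k l * lookup y l) ≡ lookup y l * (entry L l k * lookup x k)
  transposed k l = trans (cong (λ m → lookup x k * (m * lookup y l)) (L-sym k l))
                         (swap (lookup x k) (entry L l k) (lookup y l))

Q-sub : ∀ {N} (L : Mat N) → (∀ i j → entry L i j ≡ entry L j i) → ∀ a b →
  Q L (a -ᵥ b) ≡ (Q L a - dot b (L · a)) - (dot a (L · b) - Q L b)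
Q-sub L L-sym a b = begin
  dot (a -ᵥ b) (L · (a -ᵥ b))                   ≡⟨ dot-subˡ a b _ ⟩
  dot a (L · (a -ᵥ b)) - dot b (L · (a -ᵥ b))   ≡⟨ cong₂ _-_ (expand a) (expand b) ⟩
  (Q L a - dot b (L · a)) - (dot a (L · b) - Q L b) ∎
  where
  expand : ∀ c → dot c (L · (a -ᵥ b)) ≡ dot a (L · c) - dot b (L · c)
  expand c = trans (dot-·-comm L L-sym c (a -ᵥ b)) (dot-subˡ a b (L · c))

0<i-j⇒j<i : ∀ {i j} → 0ℤ < i - j → j < i
0<i-j⇒j<i {i} {j} 0<i-j = subst₂ _<_ (ℤP.+-identityˡ j) (i-j+j≡i i j) (ℤP.+-monoˡ-< j 0<i-j)
  where
  i-j+j≡i : ∀ i j → (i - j) + j ≡ i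
  i-j+j≡i = solve-∀

module _ {N} {L : Mat N} (G : IsEvenPosDefGram L) where
  open IsEvenPosDefGram G

  dot[Lb,a]≡Q[b]⇒Q[b]<Q[a] : ∀ a b → a ≢ b → dot (L · b) a ≡ Q L b → Q L b < Q L a
  dot[Lb,a]≡Q[b]⇒Q[b]<Q[a] a b a≢b ⟨Lb,a⟩≡Q[b] =
    0<i-j⇒j<i (subst (0ℤ <_) Q[a-b]≡Q[a]-Q[b] (posdef (a -ᵥ b) (a≢b ∘ -ᵥ≡0⇒≡ a b)))
    where
    ⟨a,Lb⟩≡Q[b] : dot a (L · b) ≡ Q L b
    ⟨a,Lb⟩≡Q[b] = trans (dot-comm a (L · b)) ⟨Lb,a⟩≡Q[b]
    ⟨b,La⟩≡Q[b] : dot b (L · a) ≡ Q L b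
    ⟨b,La⟩≡Q[b] = trans (dot-·-comm L symmetric b a) ⟨a,Lb⟩≡Q[b]
    cancel : ∀ u v → (u - v) - (v - v) ≡ u - v
    cancel = solve-∀
    Q[a-b]≡Q[a]-Q[b] : Q L (a -ᵥ b) ≡ Q L a - Q L b
    Q[a-b]≡Q[a]-Q[b] = begin
      Q L (a -ᵥ b)
        ≡⟨ Q-sub L symmetric a b ⟩
      (Q L a - dot b (L · a)) - (dot a (L · b) - Q L b)
        ≡⟨ cong₂ (λ u v → (Q L a - u) - (v - Q L b)) ⟨b,La⟩≡Q[b] ⟨a,Lb⟩≡Q[b] ⟩
      (Q L a - Q L b) - (Q L b - Q L b)
        ≡⟨ cancel (Q L a) (Q L b) ⟩
      Q L a - Q L b ∎

  ·-injective : Injective _≡_ _≡_ (L ·_)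
  ·-injective {a} {b} La≡Lb with VecP.≡-dec ℤ._≟_ a b
  ... | yes a≡b = a≡b
  ... | no  a≢b = ⊥-elim (ℤP.<-asym (dot[Lb,a]≡Q[b]⇒Q[b]<Q[a] a b a≢b (pairing b a La≡Lb))
                            (dot[Lb,a]≡Q[b]⇒Q[b]<Q[a] b a (a≢b ∘ sym) (pairing a b (sym La≡Lb))))
    where
    pairing : ∀ x y → L · y ≡ L · x → dot (L · x) y ≡ Q L x
    pairing x y Ly≡Lx =
      trans (dot-comm (L · x) y) (trans (dot-·-comm L symmetric y x) (cong (dot x) Ly≡Lx))

IsNeigh-refl : ∀ {N} (L : Mat N) (r : Vecℤ N) → IsNeigh L r r
IsNeigh-refl {N} L r = (replicate N 0ℤ , sym r+L0≡r) , refl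
  where
  L0≡0 : L · replicate N 0ℤ ≡ replicate N 0ℤ
  L0≡0 = trans (VecP.map-cong dot-zeroʳ L) (VecP.map-const L 0ℤ)
  r+L0≡r : r +ᵥ (L · replicate N 0ℤ) ≡ r
  r+L0≡r = trans (cong (r +ᵥ_) L0≡0) (VecP.zipWith-identityʳ ℤP.+-identityʳ r)

IsMult⇒0<mult : ∀ {N} (L : Mat N) r {k} → IsMult L r k → 0 ℕ.< k
IsMult⇒0<mult L r (xs , _ , refl , xs≐neigh) =
  ∈-length (Equivalence.from (xs≐neigh r) (IsNeigh-refl L r))

module _ {N n m} (mult : Vecℤ N → ℕ) (R : Fin n → Vecℤ N) (S : Fin m → ℤ × Vecℤ N)
         (i : Fin n) (j : Fin m) where

  Fmat-≢0⇒dot≡ : Fmat mult R S i j ≢ 0ℤ → dot (proj₂ (S j)) (R i) ≡ proj₁ (S j)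
  Fmat-≢0⇒dot≡ Fij≢0 with dot (proj₂ (S j)) (R i) ℤ.≟ proj₁ (S j)
  ... | yes s·r≡r̃ = s·r≡r̃
  ... | no  _      = contradiction refl Fij≢0

  dot≡⇒Fmat≡mult : dot (proj₂ (S j)) (R i) ≡ proj₁ (S j) → Fmat mult R S i j ≡ + mult (R i)
  dot≡⇒Fmat≡mult s·r≡r̃ with dot (proj₂ (S j)) (R i) ℤ.≟ proj₁ (S j)
  ... | yes _      = refl
  ... | no  s·r≢r̃ = contradiction s·r≡r̃ s·r≢r̃

lemma4p1 : ∀ {N : ℕ} (L : Mat N) → IsEvenPosDefGram L →
           (mult : Vecℤ N → ℕ) → (∀ r → IsMult L r (mult r)) →
           (n : ℕ) (R : Fin n → Vecℤ N) → Injective _≡_ _≡_ R →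
           ∃ λ (m : ℕ) → ∃ λ (S : Fin m → ℤ × Vecℤ N) →
             Injective _≡_ _≡_ S × (∀ j → InLZ L (proj₂ (S j))) ×
             HasRankRows (Fmat mult R S)
lemma4p1 {N} L G mult isMult n R R-injective =
  n , S , R-injective ∘ ·-injective G ∘ cong proj₂ , (λ j → R j , refl) ,
  triangular⇒HasRankRows (Fmat mult R S) (Q L ∘ R) diagonal≢0 triangular
  where
  S : Fin n → ℤ × Vecℤ N
  S j = Q L (R j) , L · R j

  diagonal≢0 : ∀ j → Fmat mult R S j j ≢ 0ℤ
  diagonal≢0 j = subst (_≢ 0ℤ) (sym (dot≡⇒Fmat≡mult mult R S j j (dot-comm (L · R j) (R j))))
                       (ℤP.<⇒≢ (ℤ.+<+ (IsMult⇒0<mult L (R j) (isMult (R j)))) ∘ sym)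

  triangular : ∀ i j → i ≢ j → Fmat mult R S i j ≢ 0ℤ → Q L (R j) < Q L (R i)
  triangular i j i≢j Fij≢0 =
    dot[Lb,a]≡Q[b]⇒Q[b]<Q[a] G (R i) (R j) (i≢j ∘ R-injective) (Fmat-≢0⇒dot≡ mult R S i j Fij≢0)
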